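{- If $A_1,\ldots,A_n\vdash_S\{\alpha\}A\{\beta\}$ is derivable in $\mathrm{SL}$, then $[\{\alpha\}A\{\beta\}]$ is provable in $S^\omega$ from the assumptions $[A_1],\ldots,[A_n]$. This extends to derivations in $\mathrm{SL}+\Delta_H+\Delta_S$ (with provability in $S^\omega+\Gamma_S$), provided the embedding of every axiom of $\Delta_H$ and of $\Delta_S$ is provable in $S^\omega+\Gamma_S$.
   Context: $\mathrm{SL}$: over a first-order signature with function symbols, ordinary predicate symbols $P$ and state predicate symbols $p$. State formulas: $\top,\bot,p(\vec t)$, closed under $\wedge,\vee,\to$. Main formulas: $\top,\bot,P(\vec t)$, $A\wedge B$, $A\vee B$, $\exists xA$, $A\Rightarrow\{\alpha\}B\{\beta\}$, $\forall x\{\alpha\}A\{\beta\}$. State sequents $\Gamma\vdash_H\alpha$: classical propositional natural deduction plus axioms $\Delta_H$. Main sequents generated by: $\Gamma\vdash_S\{\alpha\}A\{\alpha\}$ if $A\in\Gamma$; $\Gamma\vdash_S\{\alpha\}\top\{\alpha\}$; from $\{\alpha\}A\{\beta\},\{\beta\}B\{\gamma\}$ infer $\{\alpha\}A\wedge B\{\gamma\}$; from $\{\alpha\}A\wedge B\{\beta\}$ infer $\{\alpha\}A\{\beta\},\{\alpha\}B\{\beta\}$; from $\{\alpha\}A\{\beta\}$ (resp. $B$) infer $\{\alpha\}A\vee B\{\beta\}$; from $\Gamma\vdash_S\{\alpha\}A\vee B\{\beta\}$, $\Gamma,A\vdash_S\{\beta\}C\{\gamma\}$, $\Gamma,B\vdash_S\{\beta\}C\{\gamma\}$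 infer $\Gamma\vdash_S\{\alpha\}C\{\gamma\}$; from $\Gamma,A\vdash_S\{\alpha\}B\{\beta\}$ infer $\Gamma\vdash_S\{\gamma\}(A\Rightarrow\{\alpha\}B\{\beta\})\{\gamma\}$; from $\{\alpha\}(A\Rightarrow\{\gamma\}B\{\delta\})\{\beta\}$, $\{\beta\}A\{\gamma\}$ infer $\{\alpha\}B\{\delta\}$; from $\{\alpha\}\bot\{\beta\}$ infer $\{\alpha\}A\{\gamma\}$; from $\Gamma\vdash_S\{\alpha[y/x]\}A[y/x]\{\beta[y/x]\}$ infer $\Gamma\vdash_S\{\gamma\}\forall x\{\alpha\}A\{\beta\}\{\gamma\}$ ($y\equiv x$ or $y$ not free in $A,\alpha,\beta$; $y$ not free in $\Gamma$); from $\{\alpha\}\forall x\{\beta\}A\{\gamma\}\{\beta[t/x]\}$ infer $\{\alpha\}A[t/x]\{\gamma[t/x]\}$; from $\{\alpha\}A[t/x]\{\beta\}$ infer $\{\alpha\}\exists xA\{\beta\}$; from $\Gamma\vdash_S\{\alpha\}\exists xA\{\beta\}$, $\Gamma,A[y/x]\vdash_S\{\beta\}C\{\gamma\}$ infer $\Gamma\vdash_S\{\alpha\}C\{\gamma\}$ ($y\equiv x$ or $y$ not free in $A$; $y$ not free in $C,\alpha,\beta,\gamma,\Gamma$); (cons) from $\alpha\vdash_H\beta$, $\Gamma\vdash_S\{\beta\}A\{\gamma\}$, $\gamma\vdash_H\delta$ infer $\Gamma\vdash_S\{\alpha\}A\{\delta\}$; (cond) from $\vdash_H\alpha\vee\beta$,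 $\Gamma\vdash_S\{\alpha\wedge\gamma\}A\{\delta\}$, $\Gamma\vdash_S\{\beta\wedge\gamma\}A\{\delta\}$ infer $\Gamma\vdash_S\{\gamma\}A\{\delta\}$; plus axioms $\Delta_S$. $S^\omega$ is an extensional many-sorted higher-order predicate logic with a sort $D$ (domain) and a sort $S$ (states), function constants for the function symbols, ordinary predicates $P$ on $D^n$ and state predicates $p$ on $D^n\times S$; $\Gamma_S$ is a set of additional axioms. Embedding of state formulas: $[\top](\pi)=\top$, $[\bot](\pi)=\bot$, $[p(\vec t)](\pi)=p(\vec t,\pi)$, commuting with $\wedge,\vee,\to$. Embedding of main formulas: $[\top]=\top$, $[\bot]=\bot$, $[P(\vec t)]=P(\vec t)$, $[A\wedge B]=[A]\wedge[B]$, $[A\vee B]=[A]\vee[B]$, $[\exists xA]=\exists x^D[A]$, $[A\Rightarrow\{\alpha\}B\{\beta\}]=[A]\to[\{\alpha\}B\{\beta\}]$, $[\forall x\{\alpha\}A\{\beta\}]=\forall x^D[\{\alpha\}A\{\beta\}]$, where $[\{\alpha\}A\{\beta\}]:=(\exists\pi^S[\alpha](\pi))\to([A]\wedge\exists\pi'^S[\beta](\pi'))$. The embedding of an axiom $\gamma_1,\ldots,\gamma_k\vdash_H\alpha$ is $[\gamma_1](\pi)\wedge\cdots\wedge[\gamma_k](\pi)\to[\alpha](\pi)$; that of $B_1,\ldots,B_m\vdash_S\{\alpha\}B\{\beta\}$ is $[B_1]\wedge\cdots\wedge[B_m]\to[\{\alpha\}B\{\beta\}]$. -}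

module Defs where

open import Data.Nat using (ℕ; zero; suc)
open import Data.Fin using (Fin; zero; suc)
open import Data.List using (List; []; _∷_; map; foldr; replicate)
open import Data.List.Membership.Propositional using (_∈_)
open import Data.Vec using (Vec; []; _∷_)

record Signature : Set₁ where
  field
    Fun     : Set
    funAr   : Fun → ℕ
    Pred    : Set
    predAr  : Pred → ℕ
    SPred   : Set
    spredAr : SPred → ℕ

module Sys (sig : Signature) where
  open Signature sig

  data Term (n : ℕ) : Set where
    var : Fin n → Term n
    fn  : (f : Fun) → Vec (Term n) (funAr f) → Term n

  data SF (n : ℕ) : Set where
    s⊤ s⊥ : SF n
    sp    : (p : SPred) → Vec (Term n) (spredAr p) → SF n
    _s∧_ _s∨_ _s→_ : SF n → SF n → SF n

  data Form (n : ℕ) : Set where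
    m⊤ m⊥ : Form n
    mP    : (P : Pred) → Vec (Term n) (predAr P) → Form n
    _m∧_ _m∨_ : Form n → Form n → Form n
    m∃    : Form (suc n) → Form n
    mImp  : Form n → SF n → Form n → SF n → Form n      -- A ⇒ {α} B {β}
    mAll  : SF (suc n) → Form (suc n) → SF (suc n) → Form n   -- ∀x {α} A {β}

  TSub : ℕ → ℕ → Set
  TSub n m = Fin n → Term m

  mutual
    tsub : ∀ {n m} → TSub n m → Term n → Term m
    tsub σ (var i)   = σ i
    tsub σ (fn f ts) = fn f (tsubs σ ts)

    tsubs : ∀ {n m k} → TSub n m → Vec (Term n) k → Vec (Term m) k
    tsubs σ []       = []
    tsubs σ (t ∷ ts) = tsub σ t ∷ tsubs σ ts

  twk : ∀ {n} → Term n → Term (suc n)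
  twk = tsub (λ i → var (suc i))

  lift : ∀ {n m} → TSub n m → TSub (suc n) (suc m)
  lift σ zero    = var zero
  lift σ (suc i) = twk (σ i)

  ssub : ∀ {n m} → TSub n m → SF n → SF m
  ssub σ s⊤        = s⊤
  ssub σ s⊥        = s⊥
  ssub σ (sp p ts) = sp p (tsubs σ ts)
  ssub σ (a s∧ b)  = ssub σ a s∧ ssub σ b
  ssub σ (a s∨ b)  = ssub σ a s∨ ssub σ b
  ssub σ (a s→ b)  = ssub σ a s→ ssub σ b

  fsub : ∀ {n m} → TSub n m → Form n → Form m
  fsub σ m⊤            = m⊤
  fsub σ m⊥            = m⊥
  fsub σ (mP P ts)     = mP P (tsubs σ ts)
  fsub σ (A m∧ B)      = fsub σ A m∧ fsub σ B
  fsub σ (A m∨ B)      = fsub σ A m∨ fsub σ B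
  fsub σ (m∃ A)        = m∃ (fsub (lift σ) A)
  fsub σ (mImp A a B b) = mImp (fsub σ A) (ssub σ a) (fsub σ B) (ssub σ b)
  fsub σ (mAll a A b)  = mAll (ssub (lift σ) a) (fsub (lift σ) A) (ssub (lift σ) b)

  sg : ∀ {n} → Term n → TSub (suc n) n
  sg t zero    = t
  sg t (suc i) = var i

  _[_]s : ∀ {n} → SF (suc n) → Term n → SF n
  a [ t ]s = ssub (sg t) a

  _[_]f : ∀ {n} → Form (suc n) → Term n → Form n
  A [ t ]f = fsub (sg t) A

  swk : ∀ {n} → SF n → SF (suc n)
  swk = ssub (λ i → var (suc i))

  fwk : ∀ {n} → Form n → Form (suc n)
  fwk = fsub (λ i → var (suc i))

  _⊆_ : ∀ {A : Set} → List A → List A → Set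
  xs ⊆ ys = ∀ {x} → x ∈ xs → x ∈ ys

  AxiomsH : Set₁
  AxiomsH = ∀ {n} → List (SF n) → SF n → Set

  AxiomsS : Set₁
  AxiomsS = ∀ {n} → List (Form n) → SF n → Form n → SF n → Set

  data DerH (AxH : AxiomsH) {n : ℕ} : List (SF n) → SF n → Set where
    hyp  : ∀ {Γ a} → a ∈ Γ → DerH AxH Γ a
    axH  : ∀ {Γ Γ' a} → AxH Γ' a → Γ' ⊆ Γ → DerH AxH Γ a
    ⊤I   : ∀ {Γ} → DerH AxH Γ s⊤
    ⊥E   : ∀ {Γ a} → DerH AxH Γ s⊥ → DerH AxH Γ a
    ∧I   : ∀ {Γ a b} → DerH AxH Γ a → DerH AxH Γ b → DerH AxH Γ (a s∧ b)
    ∧E₁  : ∀ {Γ a b} → DerH AxH Γ (a s∧ b) → DerH AxH Γ a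
    ∧E₂  : ∀ {Γ a b} → DerH AxH Γ (a s∧ b) → DerH AxH Γ b
    ∨I₁  : ∀ {Γ a b} → DerH AxH Γ a → DerH AxH Γ (a s∨ b)
    ∨I₂  : ∀ {Γ a b} → DerH AxH Γ b → DerH AxH Γ (a s∨ b)
    ∨E   : ∀ {Γ a b c} → DerH AxH Γ (a s∨ b) → DerH AxH (a ∷ Γ) c
           → DerH AxH (b ∷ Γ) c → DerH AxH Γ c
    →I   : ∀ {Γ a b} → DerH AxH (a ∷ Γ) b → DerH AxH Γ (a s→ b)
    →E   : ∀ {Γ a b} → DerH AxH Γ (a s→ b) → DerH AxH Γ a → DerH AxH Γ b
    raa  : ∀ {Γ a} → DerH AxH ((a s→ s⊥) ∷ Γ) s⊥ → DerH AxH Γ a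

  data DerS (AxH : AxiomsH) (AxS : AxiomsS) :
       ∀ {n} → List (Form n) → SF n → Form n → SF n → Set where
    hyp   : ∀ {n} {Γ : List (Form n)} {a A} → A ∈ Γ → DerS AxH AxS Γ a A a
    axS   : ∀ {n} {Γ Γ' : List (Form n)} {a A b} → AxS Γ' a A b → Γ' ⊆ Γ
            → DerS AxH AxS Γ a A b
    ⊤I    : ∀ {n} {Γ : List (Form n)} {a} → DerS AxH AxS Γ a m⊤ a
    ∧I    : ∀ {n} {Γ : List (Form n)} {a b c A B} → DerS AxH AxS Γ a A b
            → DerS AxH AxS Γ b B c → DerS AxH AxS Γ a (A m∧ B) c
    ∧E₁   : ∀ {n} {Γ : List (Form n)} {a b A B} → DerS AxH AxS Γ a (A m∧ B) b
            → DerS AxH AxS Γ a A b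
    ∧E₂   : ∀ {n} {Γ : List (Form n)} {a b A B} → DerS AxH AxS Γ a (A m∧ B) b
            → DerS AxH AxS Γ a B b
    ∨I₁   : ∀ {n} {Γ : List (Form n)} {a b A B} → DerS AxH AxS Γ a A b
            → DerS AxH AxS Γ a (A m∨ B) b
    ∨I₂   : ∀ {n} {Γ : List (Form n)} {a b A B} → DerS AxH AxS Γ a B b
            → DerS AxH AxS Γ a (A m∨ B) b
    ∨E    : ∀ {n} {Γ : List (Form n)} {a b c A B C} → DerS AxH AxS Γ a (A m∨ B) b
            → DerS AxH AxS (A ∷ Γ) b C c → DerS AxH AxS (B ∷ Γ) b C c
            → DerS AxH AxS Γ a C c
    ⇒I    : ∀ {n} {Γ : List (Form n)} {a b c A B} → DerS AxH AxS (A ∷ Γ) a B b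
            → DerS AxH AxS Γ c (mImp A a B b) c
    ⇒E    : ∀ {n} {Γ : List (Form n)} {a b c d A B}
            → DerS AxH AxS Γ a (mImp A c B d) b → DerS AxH AxS Γ b A c
            → DerS AxH AxS Γ a B d
    ⊥E    : ∀ {n} {Γ : List (Form n)} {a b c A} → DerS AxH AxS Γ a m⊥ b
            → DerS AxH AxS Γ a A c
    -- ∀I: the eigenvariable is the fresh de Bruijn variable 0;
    -- Γ and γ are weakened, hence do not contain it.
    ∀I    : ∀ {n} {Γ : List (Form n)} {a A b c}
            → DerS AxH AxS (map fwk Γ) a A b
            → DerS AxH AxS Γ c (mAll a A b) c
    ∀E    : ∀ {n} {Γ : List (Form n)} {a b c A} (t : Term n)
            → DerS AxH AxS Γ a (mAll b A c) (b [ t ]s)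
            → DerS AxH AxS Γ a (A [ t ]f) (c [ t ]s)
    ∃I    : ∀ {n} {Γ : List (Form n)} {a b A} (t : Term n)
            → DerS AxH AxS Γ a (A [ t ]f) b
            → DerS AxH AxS Γ a (m∃ A) b
    ∃E    : ∀ {n} {Γ : List (Form n)} {a b c A C}
            → DerS AxH AxS Γ a (m∃ A) b
            → DerS AxH AxS (A ∷ map fwk Γ) (swk b) (fwk C) (swk c)
            → DerS AxH AxS Γ a C c
    cons  : ∀ {n} {Γ : List (Form n)} {a b c d A}
            → DerH AxH (a ∷ []) b → DerS AxH AxS Γ b A c → DerH AxH (c ∷ []) d
            → DerS AxH AxS Γ a A d
    cond  : ∀ {n} {Γ : List (Form n)} {a b c d A}
            → DerH AxH [] (a s∨ b) → DerS AxH AxS Γ (a s∧ c) A d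
            → DerS AxH AxS Γ (b s∧ c) A d → DerS AxH AxS Γ c A d

  -- S^ω : extensional many-sorted higher-order (classical) logic with
  -- sorts D, S and the sort O of propositions.

  infixr 5 _⇒_
  data Ty : Set where
    D S O : Ty
    _⇒_   : Ty → Ty → Ty

  Ctx : Set
  Ctx = List Ty

  data _∋_ : Ctx → Ty → Set where
    here  : ∀ {Δ τ} → (τ ∷ Δ) ∋ τ
    there : ∀ {Δ τ σ} → Δ ∋ τ → (σ ∷ Δ) ∋ τ

  Dⁿ⇒ : ℕ → Ty → Ty
  Dⁿ⇒ zero    τ = τ
  Dⁿ⇒ (suc n) τ = D ⇒ Dⁿ⇒ n τ

  data Tm (Δ : Ctx) : Ty → Set where
    var   : ∀ {τ} → Δ ∋ τ → Tm Δ τ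
    app   : ∀ {σ τ} → Tm Δ (σ ⇒ τ) → Tm Δ σ → Tm Δ τ
    lam   : ∀ {σ τ} → Tm (σ ∷ Δ) τ → Tm Δ (σ ⇒ τ)
    fun   : (f : Fun) → Tm Δ (Dⁿ⇒ (funAr f) D)
    pred  : (P : Pred) → Tm Δ (Dⁿ⇒ (predAr P) O)
    spred : (p : SPred) → Tm Δ (Dⁿ⇒ (spredAr p) (S ⇒ O))
    ⊤' ⊥' : Tm Δ O
    _∧'_ _∨'_ _⊃'_ : Tm Δ O → Tm Δ O → Tm Δ O
    all ex : (τ : Ty) → Tm (τ ∷ Δ) O → Tm Δ O
    eq    : (τ : Ty) → Tm Δ τ → Tm Δ τ → Tm Δ O

  Ren : Ctx → Ctx → Set
  Ren Δ Δ' = ∀ {τ} → Δ ∋ τ → Δ' ∋ τ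

  extR : ∀ {Δ Δ' σ} → Ren Δ Δ' → Ren (σ ∷ Δ) (σ ∷ Δ')
  extR ρ here      = here
  extR ρ (there x) = there (ρ x)

  ren : ∀ {Δ Δ' τ} → Ren Δ Δ' → Tm Δ τ → Tm Δ' τ
  ren ρ (var x)    = var (ρ x)
  ren ρ (app t u)  = app (ren ρ t) (ren ρ u)
  ren ρ (lam t)    = lam (ren (extR ρ) t)
  ren ρ (fun f)    = fun f
  ren ρ (pred P)   = pred P
  ren ρ (spred p)  = spred p
  ren ρ ⊤'         = ⊤'
  ren ρ ⊥'         = ⊥'
  ren ρ (t ∧' u)   = ren ρ t ∧' ren ρ u
  ren ρ (t ∨' u)   = ren ρ t ∨' ren ρ u
  ren ρ (t ⊃' u)   = ren ρ t ⊃' ren ρ u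
  ren ρ (all τ t)  = all τ (ren (extR ρ) t)
  ren ρ (ex τ t)   = ex τ (ren (extR ρ) t)
  ren ρ (eq τ t u) = eq τ (ren ρ t) (ren ρ u)

  wk : ∀ {Δ σ τ} → Tm Δ τ → Tm (σ ∷ Δ) τ
  wk = ren there

  Sub : Ctx → Ctx → Set
  Sub Δ Δ' = ∀ {τ} → Δ ∋ τ → Tm Δ' τ

  extS : ∀ {Δ Δ' σ} → Sub Δ Δ' → Sub (σ ∷ Δ) (σ ∷ Δ')
  extS σ here      = var here
  extS σ (there x) = wk (σ x)

  sub : ∀ {Δ Δ' τ} → Sub Δ Δ' → Tm Δ τ → Tm Δ' τ
  sub σ (var x)    = σ x
  sub σ (app t u)  = app (sub σ t) (sub σ u)
  sub σ (lam t)    = lam (sub (extS σ) t)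
  sub σ (fun f)    = fun f
  sub σ (pred P)   = pred P
  sub σ (spred p)  = spred p
  sub σ ⊤'         = ⊤'
  sub σ ⊥'         = ⊥'
  sub σ (t ∧' u)   = sub σ t ∧' sub σ u
  sub σ (t ∨' u)   = sub σ t ∨' sub σ u
  sub σ (t ⊃' u)   = sub σ t ⊃' sub σ u
  sub σ (all τ t)  = all τ (sub (extS σ) t)
  sub σ (ex τ t)   = ex τ (sub (extS σ) t)
  sub σ (eq τ t u) = eq τ (sub σ t) (sub σ u)

  sg₀ : ∀ {Δ σ} → Tm Δ σ → Sub (σ ∷ Δ) Δ
  sg₀ u here      = u
  sg₀ u (there x) = var x

  _[_]₀ : ∀ {Δ σ τ} → Tm (σ ∷ Δ) τ → Tm Δ σ → Tm Δ τ
  t [ u ]₀ = sub (sg₀ u) t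

  closed : ∀ {Δ τ} → Tm [] τ → Tm Δ τ
  closed = ren (λ ())

  data Prov (ΓS : Tm [] O → Set) : (Δ : Ctx) → List (Tm Δ O) → Tm Δ O → Set where
    hyp  : ∀ {Δ Γ φ} → φ ∈ Γ → Prov ΓS Δ Γ φ
    ax   : ∀ {Δ Γ} {φ : Tm [] O} → ΓS φ → Prov ΓS Δ Γ (closed φ)
    ⊤I   : ∀ {Δ Γ} → Prov ΓS Δ Γ ⊤'
    ⊥E   : ∀ {Δ Γ φ} → Prov ΓS Δ Γ ⊥' → Prov ΓS Δ Γ φ
    ∧I   : ∀ {Δ Γ φ ψ} → Prov ΓS Δ Γ φ → Prov ΓS Δ Γ ψ → Prov ΓS Δ Γ (φ ∧' ψ)
    ∧E₁  : ∀ {Δ Γ φ ψ} → Prov ΓS Δ Γ (φ ∧' ψ) → Prov ΓS Δ Γ φ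
    ∧E₂  : ∀ {Δ Γ φ ψ} → Prov ΓS Δ Γ (φ ∧' ψ) → Prov ΓS Δ Γ ψ
    ∨I₁  : ∀ {Δ Γ φ ψ} → Prov ΓS Δ Γ φ → Prov ΓS Δ Γ (φ ∨' ψ)
    ∨I₂  : ∀ {Δ Γ φ ψ} → Prov ΓS Δ Γ ψ → Prov ΓS Δ Γ (φ ∨' ψ)
    ∨E   : ∀ {Δ Γ φ ψ χ} → Prov ΓS Δ Γ (φ ∨' ψ) → Prov ΓS Δ (φ ∷ Γ) χ
           → Prov ΓS Δ (ψ ∷ Γ) χ → Prov ΓS Δ Γ χ
    ⊃I   : ∀ {Δ Γ φ ψ} → Prov ΓS Δ (φ ∷ Γ) ψ → Prov ΓS Δ Γ (φ ⊃' ψ)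
    ⊃E   : ∀ {Δ Γ φ ψ} → Prov ΓS Δ Γ (φ ⊃' ψ) → Prov ΓS Δ Γ φ → Prov ΓS Δ Γ ψ
    raa  : ∀ {Δ Γ φ} → Prov ΓS Δ ((φ ⊃' ⊥') ∷ Γ) ⊥' → Prov ΓS Δ Γ φ
    ∀I   : ∀ {Δ Γ τ φ} → Prov ΓS (τ ∷ Δ) (map wk Γ) φ → Prov ΓS Δ Γ (all τ φ)
    ∀E   : ∀ {Δ Γ τ φ} → Prov ΓS Δ Γ (all τ φ) → (t : Tm Δ τ) → Prov ΓS Δ Γ (φ [ t ]₀)
    ∃I   : ∀ {Δ Γ τ φ} (t : Tm Δ τ) → Prov ΓS Δ Γ (φ [ t ]₀) → Prov ΓS Δ Γ (ex τ φ)
    ∃E   : ∀ {Δ Γ τ φ ψ} → Prov ΓS Δ Γ (ex τ φ)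
           → Prov ΓS (τ ∷ Δ) (φ ∷ map wk Γ) (wk ψ) → Prov ΓS Δ Γ ψ
    eqRefl  : ∀ {Δ Γ τ} {t : Tm Δ τ} → Prov ΓS Δ Γ (eq τ t t)
    eqSubst : ∀ {Δ Γ τ} {s t : Tm Δ τ} {φ : Tm (τ ∷ Δ) O}
              → Prov ΓS Δ Γ (eq τ s t) → Prov ΓS Δ Γ (φ [ s ]₀) → Prov ΓS Δ Γ (φ [ t ]₀)
    beta    : ∀ {Δ Γ σ τ} {t : Tm (σ ∷ Δ) τ} {u : Tm Δ σ}
              → Prov ΓS Δ Γ (eq τ (app (lam t) u) (t [ u ]₀))
    funExt  : ∀ {Δ Γ σ τ} {f g : Tm Δ (σ ⇒ τ)}
              → Prov ΓS Δ Γ (all σ (eq τ (app (wk f) (var here)) (app (wk g) (var here))))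
              → Prov ΓS Δ Γ (eq (σ ⇒ τ) f g)
    propExt : ∀ {Δ Γ φ ψ} → Prov ΓS Δ Γ (φ ⊃' ψ) → Prov ΓS Δ Γ (ψ ⊃' φ)
              → Prov ΓS Δ Γ (eq O φ ψ)

  Env : ℕ → Ctx → Set
  Env n Δ = Fin n → Tm Δ D

  extEnv : ∀ {n Δ} → Env n Δ → Env (suc n) (D ∷ Δ)
  extEnv ρ zero    = var here
  extEnv ρ (suc i) = wk (ρ i)

  wkEnv : ∀ {n Δ σ} → Env n Δ → Env n (σ ∷ Δ)
  wkEnv ρ i = wk (ρ i)

  apps : ∀ {Δ τ k} → Tm Δ (Dⁿ⇒ k τ) → Vec (Tm Δ D) k → Tm Δ τ
  apps t []       = t
  apps t (u ∷ us) = apps (app t u) us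

  mutual
    embT : ∀ {n Δ} → Env n Δ → Term n → Tm Δ D
    embT ρ (var i)   = ρ i
    embT ρ (fn f ts) = apps (fun f) (embTs ρ ts)

    embTs : ∀ {n Δ k} → Env n Δ → Vec (Term n) k → Vec (Tm Δ D) k
    embTs ρ []       = []
    embTs ρ (t ∷ ts) = embT ρ t ∷ embTs ρ ts

  embSF : ∀ {n Δ} → Env n Δ → SF n → Tm Δ S → Tm Δ O
  embSF ρ s⊤        π = ⊤'
  embSF ρ s⊥        π = ⊥'
  embSF ρ (sp p ts) π = app (apps (spred p) (embTs ρ ts)) π
  embSF ρ (a s∧ b)  π = embSF ρ a π ∧' embSF ρ b π
  embSF ρ (a s∨ b)  π = embSF ρ a π ∨' embSF ρ b π
  embSF ρ (a s→ b)  π = embSF ρ a π ⊃' embSF ρ b π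

  exState : ∀ {n Δ} → Env n Δ → SF n → Tm Δ O
  exState ρ a = ex S (embSF (wkEnv ρ) a (var here))

  mutual
    embF : ∀ {n Δ} → Env n Δ → Form n → Tm Δ O
    embF ρ m⊤             = ⊤'
    embF ρ m⊥             = ⊥'
    embF ρ (mP P ts)      = apps (pred P) (embTs ρ ts)
    embF ρ (A m∧ B)       = embF ρ A ∧' embF ρ B
    embF ρ (A m∨ B)       = embF ρ A ∨' embF ρ B
    embF ρ (m∃ A)         = ex D (embF (extEnv ρ) A)
    embF ρ (mImp A a B b) = embF ρ A ⊃' embTr ρ a B b
    embF ρ (mAll a A b)   = all D (embTr (extEnv ρ) a A b)

    embTr : ∀ {n Δ} → Env n Δ → SF n → Form n → SF n → Tm Δ O
    embTr ρ a A b = exState ρ a ⊃' (embF ρ A ∧' exState ρ b)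

  Dctx : ℕ → Ctx
  Dctx n = replicate n D

  dvar : ∀ n → Env n (Dctx n)
  dvar (suc n) zero    = var here
  dvar (suc n) (suc i) = wk (dvar n i)

  conj : ∀ {Δ} → List (Tm Δ O) → Tm Δ O
  conj = foldr _∧'_ ⊤'

  embAxH : ∀ {n} → List (SF n) → SF n → Tm (S ∷ Dctx n) O
  embAxH {n} Γ a =
    conj (map (λ g → embSF (wkEnv (dvar n)) g (var here)) Γ)
      ⊃' embSF (wkEnv (dvar n)) a (var here)

  embAxS : ∀ {n} → List (Form n) → SF n → Form n → SF n → Tm (Dctx n) O
  embAxS {n} Γ a B b = conj (map (embF (dvar n)) Γ) ⊃' embTr (dvar n) a B b

-- The embedding reads {α} A {β} as "if some state satisfies α, then A holds and some
-- state satisfies β", so every rule of SL becomes a few natural-deduction steps in S^ω.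
-- The induction is carried out relative to any hypothesis list containing the embedded
-- context, so rules that discharge hypotheses just extend that list. State sequents are
-- embedded at one fresh state variable π; the consequence and case-split rules then
-- follow by unpacking the state witness of ∃π [α](π) and repacking it. The quantifier
-- rules need that the embedding commutes with substitution and weakening.
module Submission where

open import Data.Fin using (zero; suc)
open import Data.Nat using (suc)
open import Data.List using (List; []; _∷_; map)
open import Data.List.Membership.Propositional.Properties using (∈-map⁺)
open import Data.List.Properties using (map-∘; map-cong)
open import Data.List.Relation.Binary.Subset.Propositional.Properties
  using (⊆-refl; ⊆-trans; ⊆-reflexive; map⁺; xs⊆x∷xs; ∷⁺ʳ)
open import Data.List.Relation.Unary.Any using (here; there)
open import Data.Vec as Vec using (Vec; []; _∷_)
open import Relation.Binary.PropositionalEquality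

open import Defs

module TmProperties (sig : Signature) where
  open Sys sig

  ren-ren-ext : ∀ {Δ₁ Δ₂ Δ₃} {r₁ : Ren Δ₂ Δ₃} {r₂ : Ren Δ₁ Δ₂} {r₃ : Ren Δ₁ Δ₃}
    → (∀ {σ} (x : Δ₁ ∋ σ) → r₁ (r₂ x) ≡ r₃ x)
    → ∀ {ν σ} (x : (ν ∷ Δ₁) ∋ σ) → extR r₁ (extR r₂ x) ≡ extR r₃ x
  ren-ren-ext e here      = refl
  ren-ren-ext e (there x) = cong there (e x)

  ren-ren : ∀ {Δ₁ Δ₂ Δ₃ τ} {r₁ : Ren Δ₂ Δ₃} {r₂ : Ren Δ₁ Δ₂} {r₃ : Ren Δ₁ Δ₃}
    → (∀ {σ} (x : Δ₁ ∋ σ) → r₁ (r₂ x) ≡ r₃ x)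
    → (t : Tm Δ₁ τ) → ren r₁ (ren r₂ t) ≡ ren r₃ t
  ren-ren e (var x)    = cong var (e x)
  ren-ren e (app t u)  = cong₂ app (ren-ren e t) (ren-ren e u)
  ren-ren e (lam t)    = cong lam (ren-ren (ren-ren-ext e) t)
  ren-ren e (fun f)    = refl
  ren-ren e (pred P)   = refl
  ren-ren e (spred p)  = refl
  ren-ren e ⊤'         = refl
  ren-ren e ⊥'         = refl
  ren-ren e (t ∧' u)   = cong₂ _∧'_ (ren-ren e t) (ren-ren e u)
  ren-ren e (t ∨' u)   = cong₂ _∨'_ (ren-ren e t) (ren-ren e u)
  ren-ren e (t ⊃' u)   = cong₂ _⊃'_ (ren-ren e t) (ren-ren e u)
  ren-ren e (all τ t)  = cong (all τ) (ren-ren (ren-ren-ext e) t)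
  ren-ren e (ex τ t)   = cong (ex τ) (ren-ren (ren-ren-ext e) t)
  ren-ren e (eq τ t u) = cong₂ (eq τ) (ren-ren e t) (ren-ren e u)

  sub-ren-ext : ∀ {Δ₁ Δ₂ Δ₃} {θ : Sub Δ₂ Δ₃} {r : Ren Δ₁ Δ₂} {θ' : Sub Δ₁ Δ₃}
    → (∀ {σ} (x : Δ₁ ∋ σ) → θ (r x) ≡ θ' x)
    → ∀ {ν σ} (x : (ν ∷ Δ₁) ∋ σ) → extS θ (extR r x) ≡ extS θ' x
  sub-ren-ext e here      = refl
  sub-ren-ext e (there x) = cong wk (e x)

  sub-ren : ∀ {Δ₁ Δ₂ Δ₃ τ} {θ : Sub Δ₂ Δ₃} {r : Ren Δ₁ Δ₂} {θ' : Sub Δ₁ Δ₃}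
    → (∀ {σ} (x : Δ₁ ∋ σ) → θ (r x) ≡ θ' x)
    → (t : Tm Δ₁ τ) → sub θ (ren r t) ≡ sub θ' t
  sub-ren e (var x)    = e x
  sub-ren e (app t u)  = cong₂ app (sub-ren e t) (sub-ren e u)
  sub-ren e (lam t)    = cong lam (sub-ren (sub-ren-ext e) t)
  sub-ren e (fun f)    = refl
  sub-ren e (pred P)   = refl
  sub-ren e (spred p)  = refl
  sub-ren e ⊤'         = refl
  sub-ren e ⊥'         = refl
  sub-ren e (t ∧' u)   = cong₂ _∧'_ (sub-ren e t) (sub-ren e u)
  sub-ren e (t ∨' u)   = cong₂ _∨'_ (sub-ren e t) (sub-ren e u)
  sub-ren e (t ⊃' u)   = cong₂ _⊃'_ (sub-ren e t) (sub-ren e u)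
  sub-ren e (all τ t)  = cong (all τ) (sub-ren (sub-ren-ext e) t)
  sub-ren e (ex τ t)   = cong (ex τ) (sub-ren (sub-ren-ext e) t)
  sub-ren e (eq τ t u) = cong₂ (eq τ) (sub-ren e t) (sub-ren e u)

  ren-wk : ∀ {Δ Δ' σ τ} (r : Ren Δ Δ') (t : Tm Δ τ) → ren (extR {σ = σ} r) (wk t) ≡ wk (ren r t)
  ren-wk r t = trans (ren-ren (λ _ → refl) t) (sym (ren-ren (λ _ → refl) t))

  ren-sub-ext : ∀ {Δ₁ Δ₂ Δ₃} {r : Ren Δ₂ Δ₃} {θ : Sub Δ₁ Δ₂} {θ' : Sub Δ₁ Δ₃}
    → (∀ {σ} (x : Δ₁ ∋ σ) → ren r (θ x) ≡ θ' x)
    → ∀ {ν σ} (x : (ν ∷ Δ₁) ∋ σ) → ren (extR r) (extS θ x) ≡ extS θ' x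
  ren-sub-ext e here                  = refl
  ren-sub-ext {r = r} {θ} e (there x) = trans (ren-wk r (θ x)) (cong wk (e x))

  ren-sub : ∀ {Δ₁ Δ₂ Δ₃ τ} {r : Ren Δ₂ Δ₃} {θ : Sub Δ₁ Δ₂} {θ' : Sub Δ₁ Δ₃}
    → (∀ {σ} (x : Δ₁ ∋ σ) → ren r (θ x) ≡ θ' x)
    → (t : Tm Δ₁ τ) → ren r (sub θ t) ≡ sub θ' t
  ren-sub e (var x)    = e x
  ren-sub e (app t u)  = cong₂ app (ren-sub e t) (ren-sub e u)
  ren-sub e (lam t)    = cong lam (ren-sub (ren-sub-ext e) t)
  ren-sub e (fun f)    = refl
  ren-sub e (pred P)   = refl
  ren-sub e (spred p)  = refl
  ren-sub e ⊤'         = refl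
  ren-sub e ⊥'         = refl
  ren-sub e (t ∧' u)   = cong₂ _∧'_ (ren-sub e t) (ren-sub e u)
  ren-sub e (t ∨' u)   = cong₂ _∨'_ (ren-sub e t) (ren-sub e u)
  ren-sub e (t ⊃' u)   = cong₂ _⊃'_ (ren-sub e t) (ren-sub e u)
  ren-sub e (all τ t)  = cong (all τ) (ren-sub (ren-sub-ext e) t)
  ren-sub e (ex τ t)   = cong (ex τ) (ren-sub (ren-sub-ext e) t)
  ren-sub e (eq τ t u) = cong₂ (eq τ) (ren-sub e t) (ren-sub e u)

  sub-id-ext : ∀ {Δ} {θ : Sub Δ Δ}
    → (∀ {σ} (x : Δ ∋ σ) → θ x ≡ var x)
    → ∀ {ν σ} (x : (ν ∷ Δ) ∋ σ) → extS θ x ≡ var x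
  sub-id-ext e here      = refl
  sub-id-ext e (there x) = cong wk (e x)

  sub-id : ∀ {Δ τ} {θ : Sub Δ Δ}
    → (∀ {σ} (x : Δ ∋ σ) → θ x ≡ var x) → (t : Tm Δ τ) → sub θ t ≡ t
  sub-id e (var x)    = e x
  sub-id e (app t u)  = cong₂ app (sub-id e t) (sub-id e u)
  sub-id e (lam t)    = cong lam (sub-id (sub-id-ext e) t)
  sub-id e (fun f)    = refl
  sub-id e (pred P)   = refl
  sub-id e (spred p)  = refl
  sub-id e ⊤'         = refl
  sub-id e ⊥'         = refl
  sub-id e (t ∧' u)   = cong₂ _∧'_ (sub-id e t) (sub-id e u)
  sub-id e (t ∨' u)   = cong₂ _∨'_ (sub-id e t) (sub-id e u)
  sub-id e (t ⊃' u)   = cong₂ _⊃'_ (sub-id e t) (sub-id e u)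
  sub-id e (all τ t)  = cong (all τ) (sub-id (sub-id-ext e) t)
  sub-id e (ex τ t)   = cong (ex τ) (sub-id (sub-id-ext e) t)
  sub-id e (eq τ t u) = cong₂ (eq τ) (sub-id e t) (sub-id e u)

  ren-as-sub-ext : ∀ {Δ₁ Δ₂} {r : Ren Δ₁ Δ₂} {θ : Sub Δ₁ Δ₂}
    → (∀ {σ} (x : Δ₁ ∋ σ) → var (r x) ≡ θ x)
    → ∀ {ν σ} (x : (ν ∷ Δ₁) ∋ σ) → var (extR r x) ≡ extS θ x
  ren-as-sub-ext e here      = refl
  ren-as-sub-ext e (there x) = cong wk (e x)

  ren-as-sub : ∀ {Δ₁ Δ₂ τ} {r : Ren Δ₁ Δ₂} {θ : Sub Δ₁ Δ₂}
    → (∀ {σ} (x : Δ₁ ∋ σ) → var (r x) ≡ θ x) → (t : Tm Δ₁ τ) → ren r t ≡ sub θ t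
  ren-as-sub e (var x)    = e x
  ren-as-sub e (app t u)  = cong₂ app (ren-as-sub e t) (ren-as-sub e u)
  ren-as-sub e (lam t)    = cong lam (ren-as-sub (ren-as-sub-ext e) t)
  ren-as-sub e (fun f)    = refl
  ren-as-sub e (pred P)   = refl
  ren-as-sub e (spred p)  = refl
  ren-as-sub e ⊤'         = refl
  ren-as-sub e ⊥'         = refl
  ren-as-sub e (t ∧' u)   = cong₂ _∧'_ (ren-as-sub e t) (ren-as-sub e u)
  ren-as-sub e (t ∨' u)   = cong₂ _∨'_ (ren-as-sub e t) (ren-as-sub e u)
  ren-as-sub e (t ⊃' u)   = cong₂ _⊃'_ (ren-as-sub e t) (ren-as-sub e u)
  ren-as-sub e (all τ t)  = cong (all τ) (ren-as-sub (ren-as-sub-ext e) t)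
  ren-as-sub e (ex τ t)   = cong (ex τ) (ren-as-sub (ren-as-sub-ext e) t)
  ren-as-sub e (eq τ t u) = cong₂ (eq τ) (ren-as-sub e t) (ren-as-sub e u)

  wk-as-sub : ∀ {Δ σ τ} (t : Tm Δ τ) → wk {σ = σ} t ≡ sub (λ x → var (there x)) t
  wk-as-sub = ren-as-sub (λ _ → refl)

  sub-wk : ∀ {Δ Δ' σ τ} (θ : Sub Δ Δ') (t : Tm Δ τ) → sub (extS {σ = σ} θ) (wk t) ≡ wk (sub θ t)
  sub-wk θ t = trans (sub-ren (λ _ → refl) t) (sym (ren-sub (λ _ → refl) t))

  wk-[]₀ : ∀ {Δ σ τ} (t : Tm Δ τ) (u : Tm Δ σ) → (wk t) [ u ]₀ ≡ t
  wk-[]₀ t u = trans (sub-ren (λ _ → refl) t) (sub-id (λ _ → refl) t)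

  ren-extR-there-[here]₀ : ∀ {Δ σ τ} (t : Tm (σ ∷ Δ) τ) → (ren (extR there) t) [ var here ]₀ ≡ t
  ren-extR-there-[here]₀ t = trans (sub-ren inst-here t) (sub-id (λ _ → refl) t)
    where
    inst-here : ∀ {ν} (x : (_ ∷ _) ∋ ν) → sg₀ (var here) (extR there x) ≡ var x
    inst-here here      = refl
    inst-here (there x) = refl

module EmbeddingProperties (sig : Signature) where
  open Sys sig
  open TmProperties sig

  mutual
    embT-cong : ∀ {n Δ} {ρ ρ' : Env n Δ} → ρ ≗ ρ' → (t : Term n) → embT ρ t ≡ embT ρ' t
    embT-cong e (var i)   = e i
    embT-cong e (fn f ts) = cong (apps (fun f)) (embTs-cong e ts)

    embTs-cong : ∀ {n Δ k} {ρ ρ' : Env n Δ} → ρ ≗ ρ' →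
      (ts : Vec (Term n) k) → embTs ρ ts ≡ embTs ρ' ts
    embTs-cong e []       = refl
    embTs-cong e (t ∷ ts) = cong₂ _∷_ (embT-cong e t) (embTs-cong e ts)

  embSF-cong : ∀ {n Δ} {ρ ρ' : Env n Δ} → ρ ≗ ρ' →
    (a : SF n) (π : Tm Δ S) → embSF ρ a π ≡ embSF ρ' a π
  embSF-cong e s⊤        π = refl
  embSF-cong e s⊥        π = refl
  embSF-cong e (sp p ts) π = cong (λ us → app (apps (spred p) us) π) (embTs-cong e ts)
  embSF-cong e (a s∧ b)  π = cong₂ _∧'_ (embSF-cong e a π) (embSF-cong e b π)
  embSF-cong e (a s∨ b)  π = cong₂ _∨'_ (embSF-cong e a π) (embSF-cong e b π)
  embSF-cong e (a s→ b)  π = cong₂ _⊃'_ (embSF-cong e a π) (embSF-cong e b π)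

  exState-cong : ∀ {n Δ} {ρ ρ' : Env n Δ} → ρ ≗ ρ' → (a : SF n) → exState ρ a ≡ exState ρ' a
  exState-cong e a = cong (ex S) (embSF-cong (λ i → cong wk (e i)) a (var here))

  extEnv-cong : ∀ {n Δ} {ρ ρ' : Env n Δ} → ρ ≗ ρ' → extEnv ρ ≗ extEnv ρ'
  extEnv-cong e zero    = refl
  extEnv-cong e (suc i) = cong wk (e i)

  mutual
    embF-cong : ∀ {n Δ} {ρ ρ' : Env n Δ} → ρ ≗ ρ' → (A : Form n) → embF ρ A ≡ embF ρ' A
    embF-cong e m⊤             = refl
    embF-cong e m⊥             = refl
    embF-cong e (mP P ts)      = cong (apps (pred P)) (embTs-cong e ts)
    embF-cong e (A m∧ B)       = cong₂ _∧'_ (embF-cong e A) (embF-cong e B)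
    embF-cong e (A m∨ B)       = cong₂ _∨'_ (embF-cong e A) (embF-cong e B)
    embF-cong e (m∃ A)         = cong (ex D) (embF-cong (extEnv-cong e) A)
    embF-cong e (mImp A a B b) = cong₂ _⊃'_ (embF-cong e A) (embTr-cong e a B b)
    embF-cong e (mAll a A b)   = cong (all D) (embTr-cong (extEnv-cong e) a A b)

    embTr-cong : ∀ {n Δ} {ρ ρ' : Env n Δ} → ρ ≗ ρ' →
      (a : SF n) (A : Form n) (b : SF n) → embTr ρ a A b ≡ embTr ρ' a A b
    embTr-cong e a A b =
      cong₂ _⊃'_ (exState-cong e a) (cong₂ _∧'_ (embF-cong e A) (exState-cong e b))

  apps-sub : ∀ {Δ Δ' τ k} (θ : Sub Δ Δ') (f : Tm Δ (Dⁿ⇒ k τ)) (us : Vec (Tm Δ D) k) →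
    sub θ (apps f us) ≡ apps (sub θ f) (Vec.map (sub θ) us)
  apps-sub θ f []       = refl
  apps-sub θ f (u ∷ us) = apps-sub θ (app f u) us

  mutual
    embT-sub : ∀ {n Δ Δ'} (θ : Sub Δ Δ') (ρ : Env n Δ) (t : Term n) →
      sub θ (embT ρ t) ≡ embT (λ i → sub θ (ρ i)) t
    embT-sub θ ρ (var i)   = refl
    embT-sub θ ρ (fn f ts) =
      trans (apps-sub θ (fun f) (embTs ρ ts)) (cong (apps (fun f)) (embTs-sub θ ρ ts))

    embTs-sub : ∀ {n Δ Δ' k} (θ : Sub Δ Δ') (ρ : Env n Δ) (ts : Vec (Term n) k) →
      Vec.map (sub θ) (embTs ρ ts) ≡ embTs (λ i → sub θ (ρ i)) ts
    embTs-sub θ ρ []       = refl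
    embTs-sub θ ρ (t ∷ ts) = cong₂ _∷_ (embT-sub θ ρ t) (embTs-sub θ ρ ts)

  embSF-sub : ∀ {n Δ Δ'} (θ : Sub Δ Δ') (ρ : Env n Δ) (a : SF n) (π : Tm Δ S) →
    sub θ (embSF ρ a π) ≡ embSF (λ i → sub θ (ρ i)) a (sub θ π)
  embSF-sub θ ρ s⊤        π = refl
  embSF-sub θ ρ s⊥        π = refl
  embSF-sub θ ρ (sp p ts) π = cong (λ f → app f (sub θ π))
    (trans (apps-sub θ (spred p) (embTs ρ ts)) (cong (apps (spred p)) (embTs-sub θ ρ ts)))
  embSF-sub θ ρ (a s∧ b)  π = cong₂ _∧'_ (embSF-sub θ ρ a π) (embSF-sub θ ρ b π)
  embSF-sub θ ρ (a s∨ b)  π = cong₂ _∨'_ (embSF-sub θ ρ a π) (embSF-sub θ ρ b π)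
  embSF-sub θ ρ (a s→ b)  π = cong₂ _⊃'_ (embSF-sub θ ρ a π) (embSF-sub θ ρ b π)

  exState-sub : ∀ {n Δ Δ'} (θ : Sub Δ Δ') (ρ : Env n Δ) (a : SF n) →
    sub θ (exState ρ a) ≡ exState (λ i → sub θ (ρ i)) a
  exState-sub θ ρ a = cong (ex S) (trans (embSF-sub (extS θ) (wkEnv ρ) a (var here))
                                         (embSF-cong (λ i → sub-wk θ (ρ i)) a (var here)))

  extEnv-sub : ∀ {n Δ Δ'} (θ : Sub Δ Δ') (ρ : Env n Δ) →
    (λ i → sub (extS θ) (extEnv ρ i)) ≗ extEnv (λ i → sub θ (ρ i))
  extEnv-sub θ ρ zero    = refl
  extEnv-sub θ ρ (suc i) = sub-wk θ (ρ i)

  mutual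
    embF-sub : ∀ {n Δ Δ'} (θ : Sub Δ Δ') (ρ : Env n Δ) (A : Form n) →
      sub θ (embF ρ A) ≡ embF (λ i → sub θ (ρ i)) A
    embF-sub θ ρ m⊤             = refl
    embF-sub θ ρ m⊥             = refl
    embF-sub θ ρ (mP P ts)      =
      trans (apps-sub θ (pred P) (embTs ρ ts)) (cong (apps (pred P)) (embTs-sub θ ρ ts))
    embF-sub θ ρ (A m∧ B)       = cong₂ _∧'_ (embF-sub θ ρ A) (embF-sub θ ρ B)
    embF-sub θ ρ (A m∨ B)       = cong₂ _∨'_ (embF-sub θ ρ A) (embF-sub θ ρ B)
    embF-sub θ ρ (m∃ A)         = cong (ex D)
      (trans (embF-sub (extS θ) (extEnv ρ) A) (embF-cong (extEnv-sub θ ρ) A))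
    embF-sub θ ρ (mImp A a B b) = cong₂ _⊃'_ (embF-sub θ ρ A) (embTr-sub θ ρ a B b)
    embF-sub θ ρ (mAll a A b)   = cong (all D)
      (trans (embTr-sub (extS θ) (extEnv ρ) a A b) (embTr-cong (extEnv-sub θ ρ) a A b))

    embTr-sub : ∀ {n Δ Δ'} (θ : Sub Δ Δ') (ρ : Env n Δ) (a : SF n) (A : Form n) (b : SF n) →
      sub θ (embTr ρ a A b) ≡ embTr (λ i → sub θ (ρ i)) a A b
    embTr-sub θ ρ a A b =
      cong₂ _⊃'_ (exState-sub θ ρ a) (cong₂ _∧'_ (embF-sub θ ρ A) (exState-sub θ ρ b))

  wk-embT : ∀ {n Δ σ} (ρ : Env n Δ) (t : Term n) → wk {σ = σ} (embT ρ t) ≡ embT (wkEnv ρ) t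
  wk-embT ρ t = trans (wk-as-sub _)
    (trans (embT-sub _ ρ t) (embT-cong (λ i → sym (wk-as-sub (ρ i))) t))

  wk-embF : ∀ {n Δ σ} (ρ : Env n Δ) (A : Form n) → wk {σ = σ} (embF ρ A) ≡ embF (wkEnv ρ) A
  wk-embF ρ A = trans (wk-as-sub _)
    (trans (embF-sub _ ρ A) (embF-cong (λ i → sym (wk-as-sub (ρ i))) A))

  wk-embTr : ∀ {n Δ σ} (ρ : Env n Δ) (a : SF n) (A : Form n) (b : SF n) →
    wk {σ = σ} (embTr ρ a A b) ≡ embTr (wkEnv ρ) a A b
  wk-embTr ρ a A b = trans (wk-as-sub _)
    (trans (embTr-sub _ ρ a A b) (embTr-cong (λ i → sym (wk-as-sub (ρ i))) a A b))

  mutual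
    embT-tsub : ∀ {n m Δ} (ρ : Env m Δ) (σ : TSub n m) (t : Term n) →
      embT ρ (tsub σ t) ≡ embT (λ i → embT ρ (σ i)) t
    embT-tsub ρ σ (var i)   = refl
    embT-tsub ρ σ (fn f ts) = cong (apps (fun f)) (embTs-tsub ρ σ ts)

    embTs-tsub : ∀ {n m Δ k} (ρ : Env m Δ) (σ : TSub n m) (ts : Vec (Term n) k) →
      embTs ρ (tsubs σ ts) ≡ embTs (λ i → embT ρ (σ i)) ts
    embTs-tsub ρ σ []       = refl
    embTs-tsub ρ σ (t ∷ ts) = cong₂ _∷_ (embT-tsub ρ σ t) (embTs-tsub ρ σ ts)

  embSF-tsub : ∀ {n m Δ} (ρ : Env m Δ) (σ : TSub n m) (a : SF n) (π : Tm Δ S) →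
    embSF ρ (ssub σ a) π ≡ embSF (λ i → embT ρ (σ i)) a π
  embSF-tsub ρ σ s⊤        π = refl
  embSF-tsub ρ σ s⊥        π = refl
  embSF-tsub ρ σ (sp p ts) π = cong (λ us → app (apps (spred p) us) π) (embTs-tsub ρ σ ts)
  embSF-tsub ρ σ (a s∧ b)  π = cong₂ _∧'_ (embSF-tsub ρ σ a π) (embSF-tsub ρ σ b π)
  embSF-tsub ρ σ (a s∨ b)  π = cong₂ _∨'_ (embSF-tsub ρ σ a π) (embSF-tsub ρ σ b π)
  embSF-tsub ρ σ (a s→ b)  π = cong₂ _⊃'_ (embSF-tsub ρ σ a π) (embSF-tsub ρ σ b π)

  exState-tsub : ∀ {n m Δ} (ρ : Env m Δ) (σ : TSub n m) (a : SF n) →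
    exState ρ (ssub σ a) ≡ exState (λ i → embT ρ (σ i)) a
  exState-tsub ρ σ a = cong (ex S) (trans (embSF-tsub (wkEnv ρ) σ a (var here))
                                          (embSF-cong (λ i → sym (wk-embT ρ (σ i))) a (var here)))

  extEnv-tsub : ∀ {n m Δ} (ρ : Env m Δ) (σ : TSub n m) →
    (λ i → embT (extEnv ρ) (lift σ i)) ≗ extEnv (λ i → embT ρ (σ i))
  extEnv-tsub ρ σ zero    = refl
  extEnv-tsub ρ σ (suc i) = trans (embT-tsub (extEnv ρ) _ (σ i)) (sym (wk-embT ρ (σ i)))

  mutual
    embF-tsub : ∀ {n m Δ} (ρ : Env m Δ) (σ : TSub n m) (A : Form n) →
      embF ρ (fsub σ A) ≡ embF (λ i → embT ρ (σ i)) A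
    embF-tsub ρ σ m⊤             = refl
    embF-tsub ρ σ m⊥             = refl
    embF-tsub ρ σ (mP P ts)      = cong (apps (pred P)) (embTs-tsub ρ σ ts)
    embF-tsub ρ σ (A m∧ B)       = cong₂ _∧'_ (embF-tsub ρ σ A) (embF-tsub ρ σ B)
    embF-tsub ρ σ (A m∨ B)       = cong₂ _∨'_ (embF-tsub ρ σ A) (embF-tsub ρ σ B)
    embF-tsub ρ σ (m∃ A)         = cong (ex D)
      (trans (embF-tsub (extEnv ρ) (lift σ) A) (embF-cong (extEnv-tsub ρ σ) A))
    embF-tsub ρ σ (mImp A a B b) = cong₂ _⊃'_ (embF-tsub ρ σ A) (embTr-tsub ρ σ a B b)
    embF-tsub ρ σ (mAll a A b)   = cong (all D)
      (trans (embTr-tsub (extEnv ρ) (lift σ) a A b) (embTr-cong (extEnv-tsub ρ σ) a A b))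

    embTr-tsub : ∀ {n m Δ} (ρ : Env m Δ) (σ : TSub n m) (a : SF n) (A : Form n) (b : SF n) →
      embTr ρ (ssub σ a) (fsub σ A) (ssub σ b) ≡ embTr (λ i → embT ρ (σ i)) a A b
    embTr-tsub ρ σ a A b =
      cong₂ _⊃'_ (exState-tsub ρ σ a) (cong₂ _∧'_ (embF-tsub ρ σ A) (exState-tsub ρ σ b))

  extEnv-[]₀ : ∀ {n Δ} (ρ : Env n Δ) (t : Term n) →
    (λ i → (extEnv ρ i) [ embT ρ t ]₀) ≗ (λ i → embT ρ (sg t i))
  extEnv-[]₀ ρ t zero    = refl
  extEnv-[]₀ ρ t (suc i) = wk-[]₀ (ρ i) (embT ρ t)

  embF-[]₀ : ∀ {n Δ} (ρ : Env n Δ) (t : Term n) (A : Form (suc n)) →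
    (embF (extEnv ρ) A) [ embT ρ t ]₀ ≡ embF ρ (A [ t ]f)
  embF-[]₀ ρ t A = begin
    (embF (extEnv ρ) A) [ embT ρ t ]₀          ≡⟨ embF-sub _ (extEnv ρ) A ⟩
    embF (λ i → (extEnv ρ i) [ embT ρ t ]₀) A  ≡⟨ embF-cong (extEnv-[]₀ ρ t) A ⟩
    embF (λ i → embT ρ (sg t i)) A             ≡⟨ embF-tsub ρ (sg t) A ⟨
    embF ρ (A [ t ]f)                          ∎
    where open ≡-Reasoning

  embTr-[]₀ : ∀ {n Δ} (ρ : Env n Δ) (t : Term n) (b : SF (suc n)) (A : Form (suc n)) c →
    (embTr (extEnv ρ) b A c) [ embT ρ t ]₀ ≡ embTr ρ (b [ t ]s) (A [ t ]f) (c [ t ]s)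
  embTr-[]₀ ρ t b A c = begin
    (embTr (extEnv ρ) b A c) [ embT ρ t ]₀          ≡⟨ embTr-sub _ (extEnv ρ) b A c ⟩
    embTr (λ i → (extEnv ρ i) [ embT ρ t ]₀) b A c  ≡⟨ embTr-cong (extEnv-[]₀ ρ t) b A c ⟩
    embTr (λ i → embT ρ (sg t i)) b A c             ≡⟨ embTr-tsub ρ (sg t) b A c ⟨
    embTr ρ (b [ t ]s) (A [ t ]f) (c [ t ]s)        ∎
    where open ≡-Reasoning

  dvar-suc : ∀ {n} → dvar (suc n) ≗ extEnv (dvar n)
  dvar-suc zero    = refl
  dvar-suc (suc i) = refl

  embF-dvar-fwk : ∀ {n} (C : Form n) → embF (dvar (suc n)) (fwk C) ≡ wk (embF (dvar n) C)
  embF-dvar-fwk {n} C = trans (embF-tsub (dvar (suc n)) _ C) (sym (wk-embF (dvar n) C))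

  embTr-dvar-wk : ∀ {n} (b : SF n) (C : Form n) (c : SF n) →
    embTr (dvar (suc n)) (swk b) (fwk C) (swk c) ≡ wk (embTr (dvar n) b C c)
  embTr-dvar-wk {n} b C c =
    trans (embTr-tsub (dvar (suc n)) _ b C c) (sym (wk-embTr (dvar n) b C c))

module ProvProperties (sig : Signature) (ΓS : Sys.Tm sig [] Sys.O → Set) where
  open Sys sig
  open TmProperties sig

  infix 3 _⊢_
  _⊢_ : ∀ {Δ} → List (Tm Δ O) → Tm Δ O → Set
  G ⊢ φ = Prov ΓS _ G φ

  ⊢-resp : ∀ {Δ} {G : List (Tm Δ O)} {φ ψ} → φ ≡ ψ → G ⊢ φ → G ⊢ ψ
  ⊢-resp refl p = p

  weaken : ∀ {Δ} {G G' : List (Tm Δ O)} {φ} → G ⊆ G' → G ⊢ φ → G' ⊢ φ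
  weaken s (hyp m)       = hyp (s m)
  weaken s (ax x)        = ax x
  weaken s ⊤I            = ⊤I
  weaken s (⊥E p)        = ⊥E (weaken s p)
  weaken s (∧I p q)      = ∧I (weaken s p) (weaken s q)
  weaken s (∧E₁ p)       = ∧E₁ (weaken s p)
  weaken s (∧E₂ p)       = ∧E₂ (weaken s p)
  weaken s (∨I₁ p)       = ∨I₁ (weaken s p)
  weaken s (∨I₂ p)       = ∨I₂ (weaken s p)
  weaken s (∨E p q r)    = ∨E (weaken s p) (weaken (∷⁺ʳ _ s) q) (weaken (∷⁺ʳ _ s) r)
  weaken s (⊃I p)        = ⊃I (weaken (∷⁺ʳ _ s) p)
  weaken s (⊃E p q)      = ⊃E (weaken s p) (weaken s q)
  weaken s (raa p)       = raa (weaken (∷⁺ʳ _ s) p)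
  weaken s (∀I p)        = ∀I (weaken (map⁺ wk s) p)
  weaken s (∀E p t)      = ∀E (weaken s p) t
  weaken s (∃I t p)      = ∃I t (weaken s p)
  weaken s (∃E p q)      = ∃E (weaken s p) (weaken (∷⁺ʳ _ (map⁺ wk s)) q)
  weaken s eqRefl        = eqRefl
  weaken s (eqSubst {φ = φ} p q) = eqSubst {φ = φ} (weaken s p) (weaken s q)
  weaken s beta          = beta
  weaken s (funExt p)    = funExt (weaken s p)
  weaken s (propExt p q) = propExt (weaken s p) (weaken s q)

  weaken₁ : ∀ {Δ} {G : List (Tm Δ O)} {ψ φ} → G ⊢ φ → ψ ∷ G ⊢ φ
  weaken₁ = weaken (xs⊆x∷xs _ _)

  hyp₀ : ∀ {Δ} {G : List (Tm Δ O)} {φ} → φ ∷ G ⊢ φ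
  hyp₀ = hyp (here refl)

  conj-hyps : ∀ {Δ} {G : List (Tm Δ O)} (L : List (Tm Δ O)) → L ⊆ G → G ⊢ conj L
  conj-hyps []      L⊆G = ⊤I
  conj-hyps (φ ∷ L) L⊆G = ∧I (hyp (L⊆G (here refl))) (conj-hyps L (λ m → L⊆G (there m)))

  ⊃E-conj-hyps : ∀ {Δ} {G L : List (Tm Δ O)} {φ} → [] ⊢ conj L ⊃' φ → L ⊆ G → G ⊢ φ
  ⊃E-conj-hyps {L = L} p L⊆G = ⊃E (weaken (λ ()) p) (conj-hyps L L⊆G)

  ∃S-intro-here : ∀ {Δ} {G : List (Tm (S ∷ Δ) O)} {φ : Tm (S ∷ Δ) O} →
    G ⊢ φ → G ⊢ wk (ex S φ)
  ∃S-intro-here {φ = φ} p = ∃I (var here) (⊢-resp (sym (ren-extR-there-[here]₀ φ)) p)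

module Soundness (sig : Signature) where
  open Sys sig
  open EmbeddingProperties sig

  module _ (AxH : AxiomsH) (AxS : AxiomsS) (ΓS : Tm [] O → Set)
    (embAxH-prov : ∀ {n} {Γ : List (SF n)} {a : SF n} → AxH Γ a →
       Prov ΓS (S ∷ Dctx n) [] (embAxH Γ a))
    (embAxS-prov : ∀ {n} {Γ : List (Form n)} {a : SF n} {B : Form n} {b : SF n} →
       AxS Γ a B b → Prov ΓS (Dctx n) [] (embAxS Γ a B b))
    where
    open ProvProperties sig ΓS

    ⟦_⟧ : ∀ {n} → Form n → Tm (Dctx n) O
    ⟦_⟧ = embF (dvar _)

    ∃⟦_⟧ : ∀ {n} → SF n → Tm (Dctx n) O
    ∃⟦_⟧ = exState (dvar _)

    ⟦_⟧ₛ : ∀ {n} → SF n → Tm (S ∷ Dctx n) O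
    ⟦ a ⟧ₛ = embSF (wkEnv (dvar _)) a (var here)

    soundnessH : ∀ {n} {Γ : List (SF n)} {a} → DerH AxH Γ a → map ⟦_⟧ₛ Γ ⊢ ⟦ a ⟧ₛ
    soundnessH (hyp m)      = hyp (∈-map⁺ ⟦_⟧ₛ m)
    soundnessH (axH δ Γ⊆)   = ⊃E-conj-hyps (embAxH-prov δ) (map⁺ ⟦_⟧ₛ Γ⊆)
    soundnessH ⊤I           = ⊤I
    soundnessH (⊥E d)       = ⊥E (soundnessH d)
    soundnessH (∧I d e)     = ∧I (soundnessH d) (soundnessH e)
    soundnessH (∧E₁ d)      = ∧E₁ (soundnessH d)
    soundnessH (∧E₂ d)      = ∧E₂ (soundnessH d)
    soundnessH (∨I₁ d)      = ∨I₁ (soundnessH d)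
    soundnessH (∨I₂ d)      = ∨I₂ (soundnessH d)
    soundnessH (∨E d e f)   = ∨E (soundnessH d) (soundnessH e) (soundnessH f)
    soundnessH (→I d)       = ⊃I (soundnessH d)
    soundnessH (→E d e)     = ⊃E (soundnessH d) (soundnessH e)
    soundnessH (raa d)      = raa (soundnessH d)

    ∃⟦⟧-mono : ∀ {n} {G : List (Tm (Dctx n) O)} {a b : SF n} →
      DerH AxH (a ∷ []) b → G ⊢ ∃⟦ a ⟧ → G ⊢ ∃⟦ b ⟧
    ∃⟦⟧-mono d pre = ∃E pre (∃S-intro-here (weaken (∷⁺ʳ _ (λ ())) (soundnessH d)))

    ∃⟦⟧-split : ∀ {n} {G : List (Tm (Dctx n) O)} {a b c : SF n} →
      DerH AxH [] (a s∨ b) → G ⊢ ∃⟦ c ⟧ → G ⊢ ∃⟦ a s∧ c ⟧ ∨' ∃⟦ b s∧ c ⟧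
    ∃⟦⟧-split d pre = ∃E pre (∨E (weaken (λ ()) (soundnessH d))
      (∨I₁ (∃S-intro-here (∧I hyp₀ (weaken₁ hyp₀))))
      (∨I₂ (∃S-intro-here (∧I hyp₀ (weaken₁ hyp₀)))))

    map-fwk-⊆ : ∀ {n} {Γ : List (Form n)} {G} →
      map ⟦_⟧ Γ ⊆ G → map ⟦_⟧ (map fwk Γ) ⊆ map wk G
    map-fwk-⊆ {Γ = Γ} Γ⊆G = ⊆-trans (⊆-reflexive map-⟦fwk⟧) (map⁺ wk Γ⊆G)
      where
      open ≡-Reasoning
      map-⟦fwk⟧ : map ⟦_⟧ (map fwk Γ) ≡ map wk (map ⟦_⟧ Γ)
      map-⟦fwk⟧ = begin
        map ⟦_⟧ (map fwk Γ)              ≡⟨ map-∘ Γ ⟨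
        map (λ C → ⟦ fwk C ⟧) Γ          ≡⟨ map-cong embF-dvar-fwk Γ ⟩
        map (λ C → wk ⟦ C ⟧) Γ           ≡⟨ map-∘ Γ ⟩
        map wk (map ⟦_⟧ Γ)               ∎

    ∀D-intro : ∀ {n} {G} {a : SF (suc n)} {A b} →
      map wk G ⊢ embTr (dvar (suc n)) a A b → G ⊢ ⟦ mAll a A b ⟧
    ∀D-intro {a = a} {A} {b} p = ∀I (⊢-resp (embTr-cong dvar-suc a A b) p)

    ∃D-elim : ∀ {n} {G} {A : Form (suc n)} {b C c} →
      G ⊢ ⟦ m∃ A ⟧ → ⟦ A ⟧ ∷ map wk G ⊢ embTr (dvar (suc n)) (swk b) (fwk C) (swk c) →
      G ⊢ embTr (dvar n) b C c
    ∃D-elim {G = G} {A} {b} {C} {c} ex-A p = ∃E ex-A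
      (subst₂ (λ H → H ∷ map wk G ⊢_) (embF-cong dvar-suc A) (embTr-dvar-wk b C c) p)

    mutual
      soundness : ∀ {n} {Γ : List (Form n)} {a A b} {G} → DerS AxH AxS Γ a A b →
        map ⟦_⟧ Γ ⊆ G → G ⊢ ∃⟦ a ⟧ → G ⊢ ⟦ A ⟧ ∧' ∃⟦ b ⟧
      soundness (hyp A∈Γ) Γ⊆G pre = ∧I (hyp (Γ⊆G (∈-map⁺ ⟦_⟧ A∈Γ))) pre
      soundness (axS δ Γ'⊆Γ) Γ⊆G pre =
        ⊃E (⊃E-conj-hyps (embAxS-prov δ) (⊆-trans (map⁺ ⟦_⟧ Γ'⊆Γ) Γ⊆G)) pre
      soundness ⊤I Γ⊆G pre = ∧I ⊤I pre
      soundness (∧I d e) Γ⊆G pre =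
        let q = soundness d Γ⊆G pre ; r = soundness e Γ⊆G (∧E₂ q) in
        ∧I (∧I (∧E₁ q) (∧E₁ r)) (∧E₂ r)
      soundness (∧E₁ d) Γ⊆G pre = let q = soundness d Γ⊆G pre in ∧I (∧E₁ (∧E₁ q)) (∧E₂ q)
      soundness (∧E₂ d) Γ⊆G pre = let q = soundness d Γ⊆G pre in ∧I (∧E₂ (∧E₁ q)) (∧E₂ q)
      soundness (∨I₁ d) Γ⊆G pre = let q = soundness d Γ⊆G pre in ∧I (∨I₁ (∧E₁ q)) (∧E₂ q)
      soundness (∨I₂ d) Γ⊆G pre = let q = soundness d Γ⊆G pre in ∧I (∨I₂ (∧E₁ q)) (∧E₂ q)
      soundness (∨E d e f) Γ⊆G pre =
        let q = soundness d Γ⊆G pre in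
        ∨E (∧E₁ q) (soundness e (∷⁺ʳ _ Γ⊆G) (weaken₁ (∧E₂ q)))
                   (soundness f (∷⁺ʳ _ Γ⊆G) (weaken₁ (∧E₂ q)))
      soundness (⇒I d) Γ⊆G pre = ∧I (⊃I (soundness⊃ d (∷⁺ʳ _ Γ⊆G))) pre
      soundness (⇒E d e) Γ⊆G pre =
        let q = soundness d Γ⊆G pre ; r = soundness e Γ⊆G (∧E₂ q) in
        ⊃E (⊃E (∧E₁ q) (∧E₁ r)) (∧E₂ r)
      soundness (⊥E d) Γ⊆G pre = ⊥E (∧E₁ (soundness d Γ⊆G pre))
      soundness (∀I {A = A} d) Γ⊆G pre = ∧I (∀D-intro {A = A} (soundness⊃ d (map-fwk-⊆ Γ⊆G))) pre
      soundness (∀E {b = b} {c} {A} t d) Γ⊆G pre =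
        let q = soundness d Γ⊆G pre in
        ⊃E (⊢-resp (embTr-[]₀ (dvar _) t b A c) (∀E (∧E₁ q) (embT (dvar _) t))) (∧E₂ q)
      soundness (∃I {A = A} t d) Γ⊆G pre =
        let q = soundness d Γ⊆G pre in
        ∧I (∃I (embT (dvar _) t) (⊢-resp (sym (embF-[]₀ (dvar _) t A)) (∧E₁ q))) (∧E₂ q)
      soundness (∃E {A = A} {C} d e) Γ⊆G pre =
        let q = soundness d Γ⊆G pre in
        ⊃E (∃D-elim {A = A} {C = C} (∧E₁ q) (soundness⊃ e (∷⁺ʳ _ (map-fwk-⊆ Γ⊆G)))) (∧E₂ q)
      soundness (cons h d k) Γ⊆G pre =
        let q = soundness d Γ⊆G (∃⟦⟧-mono h pre) in ∧I (∧E₁ q) (∃⟦⟧-mono k (∧E₂ q))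
      soundness (cond h d e) Γ⊆G pre =
        ∨E (∃⟦⟧-split h pre) (soundness d (λ m → there (Γ⊆G m)) hyp₀)
                             (soundness e (λ m → there (Γ⊆G m)) hyp₀)

      soundness⊃ : ∀ {n} {Γ : List (Form n)} {a A b} {G} → DerS AxH AxS Γ a A b →
        map ⟦_⟧ Γ ⊆ G → G ⊢ embTr (dvar n) a A b
      soundness⊃ d Γ⊆G = ⊃I (soundness d (λ m → there (Γ⊆G m)) hyp₀)

proposition4p5 : (sig : Signature) → let open Sys sig in
    (AxH : AxiomsH) (AxS : AxiomsS) (ΓS : Tm [] O → Set) →
    (∀ {n} {Γ : List (SF n)} {a : SF n} → AxH Γ a →
       Prov ΓS (S ∷ Dctx n) [] (embAxH Γ a)) →
    (∀ {n} {Γ : List (Form n)} {a : SF n} {B : Form n} {b : SF n} → AxS Γ a B b →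
       Prov ΓS (Dctx n) [] (embAxS Γ a B b)) →
    ∀ {n} {Γ : List (Form n)} {a : SF n} {A : Form n} {b : SF n} →
    DerS AxH AxS Γ a A b →
    Prov ΓS (Dctx n) (map (embF (dvar n)) Γ) (embTr (dvar n) a A b)
proposition4p5 sig AxH AxS ΓS embAxH-prov embAxS-prov d =
  Soundness.soundness⊃ sig AxH AxS ΓS embAxH-prov embAxS-prov d ⊆-refl
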